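{- Let $k_1\ge k_2$ be nonnegative integers and $J\subseteq[k_1+k_2-1]$. Then \[ \bigl|\{T\in\mathrm{SYT}(k_1,k_2)\mid \mathrm{Des}(T)\supseteq J\}\bigr| = \bigl|\{T\in\mathrm{SYT}(k_1+1,k_2+1)\mid \mathrm{Des}(T)\supseteq \{1\}\cup(J+2)\}\bigr|, \] where $J+2=\{j+2\mid j\in J\}$.
   Context: $\mathrm{SYT}(\lambda)$ is the set of standard Young tableaux of shape $\lambda$ (English notation); $\mathrm{SYT}(k_1,0)$ means the one-row shape. For a standard Young tableau $T$ with $N$ cells, $\mathrm{Des}(T)=\{i\in[N-1]\mid i+1\text{ appears in a lower row than } i\}$. -}

module Defs where

open import Data.Nat using (ℕ; zero; suc; _+_; _∸_; _<ᵇ_; _≡ᵇ_)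
open import Data.Bool using (Bool; true; false; _∧_; _∨_; not; if_then_else_)
open import Data.List using (List; []; _∷_; _++_; upTo)
open import Data.Vec using (Vec; toList; lookup)
open import Data.Fin using (Fin; toℕ)
open import Data.Fin.Subset using (Subset)
open import Data.Maybe using (Maybe; just; nothing)
open import Data.Product using (_×_; _,_)
open import Data.List using (allFin)

-- A filling of the two-row Young diagram of shape (a , b) (English notation):
-- first component = top row (left to right), second = bottom row.
Tab : ℕ → ℕ → Set
Tab a b = Vec ℕ a × Vec ℕ b

allᵇ : {A : Set} → (A → Bool) → List A → Bool
allᵇ p []       = true
allᵇ p (x ∷ xs) = p x ∧ allᵇ p xs

incr : List ℕ → Bool
incr []           = true
incr (x ∷ [])     = true
incr (x ∷ y ∷ xs) = (x <ᵇ y) ∧ incr (y ∷ xs)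

-- columns strictly increase downwards: top[i] < bot[i] for every column i
-- having a cell in the bottom row (bottom row is never longer than the top)
cols : List ℕ → List ℕ → Bool
cols _        []       = true
cols []       (_ ∷ _)  = false
cols (x ∷ xs) (y ∷ ys) = (x <ᵇ y) ∧ cols xs ys

occ : ℕ → List ℕ → ℕ
occ k []       = 0
occ k (x ∷ xs) = if k ≡ᵇ x then suc (occ k xs) else occ k xs

isSYT : ∀ {a b} → Tab a b → Bool
isSYT {a} {b} (r₁ , r₂) =
  incr (toList r₁) ∧ incr (toList r₂) ∧ cols (toList r₁) (toList r₂) ∧
  allᵇ (λ k → occ (suc k) (toList r₁ ++ toList r₂) ≡ᵇ 1) (upTo (a + b))

_∈ᵇ_ : ℕ → List ℕ → Bool
k ∈ᵇ xs = not (occ k xs ≡ᵇ 0)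

-- i ∈ Des(T): i + 1 appears in a lower row than i.
-- For a two-row tableau: i in the top row and i + 1 in the bottom row.
isDes : ∀ {a b} → Tab a b → ℕ → Bool
isDes (r₁ , r₂) i = (i ∈ᵇ toList r₁) ∧ (suc i ∈ᵇ toList r₂)

-- J ⊆ [n] is encoded as a Subset n; the element j : Fin n stands for toℕ j + 1.
-- Des(T) ⊇ (J + s)  (shift s)
desSup : ∀ {n a b} → ℕ → Subset n → Tab a b → Bool
desSup s J t = allᵇ (λ j → not (lookup J j) ∨ isDes t (suc (toℕ j) + s)) (allFin _)

-- Prepending the column (1 over 2) and adding 2 to every other entry sends a
-- standard tableau of shape (k₁ , k₂) to one of shape (k₁ + 1 , k₂ + 1) in which
-- 1 is a descent, and turns each descent i into the descent i + 2. Conversely, in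
-- a standard tableau with 1 ∈ Des the first column is exactly (1 over 2), so
-- deleting it and subtracting 2 inverts the construction. The one subtle point is
-- that 0 never occurs in a standard filling: a list of length n containing each of
-- 1 … n has no room left for 0.
module Submission where

open import Defs
open import Data.Bool using (Bool; true; false; T; _∧_; _∨_; not; if_then_else_)
open import Data.Bool.Properties using (T-∧; T-≡; T-irrelevant)
open import Data.Fin using (Fin; toℕ)
open import Data.Fin.Properties using (toℕ<n; toℕ-injective; injective⇒≤)
open import Data.Fin.Subset using (Subset)
open import Data.List as List using (List; []; _∷_; _++_; length; upTo; applyUpTo; allFin)
open import Data.List.Properties using (length-++; map-++; map-applyUpTo)
open import Data.List.Membership.Propositional using (_∈_)
open import Data.List.Relation.Unary.All as All using (All; []; _∷_)
open import Data.List.Relation.Unary.All.Properties using (applyUpTo⁻)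
open import Data.List.Relation.Unary.Any using (here; there; index)
open import Data.List.Relation.Unary.Any.Properties using (lookup-index)
open import Data.Nat
open import Data.Nat.Properties
open import Data.Product using (Σ; _×_; _,_; proj₁; proj₂)
open import Data.Product.Properties using (Σ-≡,≡→≡)
open import Data.Product.Function.NonDependent.Propositional using (_×-⇔_)
open import Data.Vec as Vec using (Vec; toList; lookup)
open import Data.Vec.Properties using (toList-map; length-toList; map-∘; map-cong; map-id)
open import Function using (_∘_; id)
open import Function.Bundles using (_↔_; _⇔_; mk↔ₛ′; mk⇔; Equivalence)
open import Function.Definitions using (Injective)
import Function.Properties.Equivalence as ⇔
open import Relation.Binary.PropositionalEquality
open import Relation.Nullary using (contradiction)
open ≡-Reasoning

T-∧⁻ : ∀ {x y} → T (x ∧ y) → T x × T y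
T-∧⁻ = Equivalence.to T-∧

allᵇ-cong : ∀ {A : Set} {p q : A → Bool} → (∀ x → p x ≡ q x) → ∀ xs → allᵇ p xs ≡ allᵇ q xs
allᵇ-cong p≗q []       = refl
allᵇ-cong p≗q (x ∷ xs) = cong₂ _∧_ (p≗q x) (allᵇ-cong p≗q xs)

allᵇ-map : ∀ {A B : Set} {p : B → Bool} (f : A → B) xs → allᵇ p (List.map f xs) ≡ allᵇ (p ∘ f) xs
allᵇ-map f []       = refl
allᵇ-map f (x ∷ xs) = cong (_ ∧_) (allᵇ-map f xs)

allᵇ⇒All : ∀ {A : Set} {p : A → Bool} xs → T (allᵇ p xs) → All (T ∘ p) xs
allᵇ⇒All []       _ = []
allᵇ⇒All (x ∷ xs) h = proj₁ (T-∧⁻ h) ∷ allᵇ⇒All xs (proj₂ (T-∧⁻ h))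

+-cancelˡ-≡ᵇ : ∀ n {m o} → (n + m ≡ᵇ n + o) ≡ (m ≡ᵇ o)
+-cancelˡ-≡ᵇ zero    = refl
+-cancelˡ-≡ᵇ (suc n) = +-cancelˡ-≡ᵇ n

+-cancelˡ-<ᵇ : ∀ n {m o} → (n + m <ᵇ n + o) ≡ (m <ᵇ o)
+-cancelˡ-<ᵇ zero    = refl
+-cancelˡ-<ᵇ (suc n) = +-cancelˡ-<ᵇ n

m<n⇒m≡ᵇn+o≡false : ∀ {m n} o → m < n → (m ≡ᵇ n + o) ≡ false
m<n⇒m≡ᵇn+o≡false {zero}  {suc n} o _         = refl
m<n⇒m≡ᵇn+o≡false {suc m} {suc n} o (s≤s m<n) = m<n⇒m≡ᵇn+o≡false o m<n

occ-++ : ∀ k xs ys → occ k (xs ++ ys) ≡ occ k xs + occ k ys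
occ-++ k []       ys = refl
occ-++ k (x ∷ xs) ys with k ≡ᵇ x
... | true  = cong suc (occ-++ k xs ys)
... | false = occ-++ k xs ys

occ-++-∷ : ∀ k xs y ys → occ k (xs ++ y ∷ ys) ≡ occ k (y ∷ xs ++ ys)
occ-++-∷ k []       y ys = refl
occ-++-∷ k (x ∷ xs) y ys with k ≡ᵇ x | k ≡ᵇ y | occ-++-∷ k xs y ys
... | true  | true  | ih = cong suc ih
... | true  | false | ih = cong suc ih
... | false | _     | ih = ih

occ-map-+ : ∀ n k xs → occ (n + k) (List.map (n +_) xs) ≡ occ k xs
occ-map-+ n k []       = refl
occ-map-+ n k (x ∷ xs) =
  cong₂ (λ b m → if b then suc m else m) (+-cancelˡ-≡ᵇ n) (occ-map-+ n k xs)

occ-map-+-< : ∀ {k n} xs → k < n → occ k (List.map (n +_) xs) ≡ 0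
occ-map-+-< []       _   = refl
occ-map-+-< (x ∷ xs) k<n =
  cong₂ (λ b m → if b then suc m else m) (m<n⇒m≡ᵇn+o≡false x k<n) (occ-map-+-< xs k<n)

∈ᵇ-map-+ : ∀ n k xs → (n + k) ∈ᵇ List.map (n +_) xs ≡ k ∈ᵇ xs
∈ᵇ-map-+ n k xs = cong (λ m → not (m ≡ᵇ 0)) (occ-map-+ n k xs)

occ≢0⇒∈ : ∀ {k} xs → occ k xs ≢ 0 → k ∈ xs
occ≢0⇒∈     []       h = contradiction refl h
occ≢0⇒∈ {k} (x ∷ xs) h with k ≡ᵇ x in k≡ᵇx
... | true  = here (≡ᵇ⇒≡ k x (Equivalence.from T-≡ k≡ᵇx))
... | false = there (occ≢0⇒∈ xs h)

∈ᵇ⇒∈ : ∀ {k} xs → T (k ∈ᵇ xs) → k ∈ xs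
∈ᵇ⇒∈ xs h = occ≢0⇒∈ xs (λ occ≡0 → subst (λ m → T (not (m ≡ᵇ 0))) occ≡0 h)

occ0≡0⇒head>0 : ∀ {x} xs → occ 0 (x ∷ xs) ≡ 0 → 0 < x
occ0≡0⇒head>0 {zero}  _ ()
occ0≡0⇒head>0 {suc x} _ _ = z<s

pigeonhole-occ0 : ∀ {n} xs → length xs ≡ n → (∀ {k} → k < n → suc k ∈ xs) → occ 0 xs ≡ 0
pigeonhole-occ0 {n} xs len 1…n∈xs with occ 0 xs in occ0
... | zero  = refl
... | suc _ = contradiction (subst (suc n ≤_) len (injective⇒≤ position-injective)) (n≮n n)
  where
  member : ∀ {k} → k < suc n → k ∈ xs
  member {zero}  _         = occ≢0⇒∈ xs (λ occ≡0 → 0≢1+n (trans (sym occ≡0) occ0))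
  member {suc k} (s≤s k<n) = 1…n∈xs k<n

  position : Fin (suc n) → Fin (length xs)
  position i = index (member (toℕ<n i))

  position-injective : Injective _≡_ _≡_ position
  position-injective {i} {j} eq = toℕ-injective (begin
    toℕ i                        ≡⟨ lookup-index (member (toℕ<n i)) ⟩
    List.lookup xs (position i)  ≡⟨ cong (List.lookup xs) eq ⟩
    List.lookup xs (position j)  ≡⟨ lookup-index (member (toℕ<n j)) ⟨
    toℕ j                        ∎)

incr-map-+ : ∀ n xs → incr (List.map (n +_) xs) ≡ incr xs
incr-map-+ n []           = refl
incr-map-+ n (x ∷ [])     = refl
incr-map-+ n (x ∷ y ∷ xs) = cong₂ _∧_ (+-cancelˡ-<ᵇ n) (incr-map-+ n (y ∷ xs))

incr-∷-map-+ : ∀ {k n} xs → k < n → incr (k ∷ List.map (n +_) xs) ≡ incr xs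
incr-∷-map-+         []       _   = refl
incr-∷-map-+ {n = n} (x ∷ xs) k<n =
  cong₂ _∧_ (Equivalence.to T-≡ (<⇒<ᵇ (≤-trans k<n (m≤m+n n x)))) (incr-map-+ n (x ∷ xs))

incr-0∷ : ∀ ys → occ 0 ys ≡ 0 → incr (0 ∷ ys) ≡ incr ys
incr-0∷ []           _ = refl
incr-0∷ (zero ∷ ys)  ()
incr-0∷ (suc y ∷ ys) _ = refl

incr⇒head<tail : ∀ {x} xs → T (incr (x ∷ xs)) → All (x <_) xs
incr⇒head<tail     []       _ = []
incr⇒head<tail {x} (y ∷ ys) h = x<y ∷ All.map (<-trans x<y) (incr⇒head<tail ys (proj₂ (T-∧⁻ h)))
  where
  x<y : x < y
  x<y = <ᵇ⇒< x y (proj₁ (T-∧⁻ h))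

incr⇒head≤ : ∀ {x k} xs → T (incr (x ∷ xs)) → T (k ∈ᵇ (x ∷ xs)) → x ≤ k
incr⇒head≤ xs inc k∈ with ∈ᵇ⇒∈ (_ ∷ xs) k∈
... | here k≡x   = ≤-reflexive (sym k≡x)
... | there k∈xs = <⇒≤ (All.lookup (incr⇒head<tail xs inc) k∈xs)

cols-map-+ : ∀ n xs ys → cols (List.map (n +_) xs) (List.map (n +_) ys) ≡ cols xs ys
cols-map-+ n xs       []       = refl
cols-map-+ n []       (y ∷ ys) = refl
cols-map-+ n (x ∷ xs) (y ∷ ys) = cong₂ _∧_ (+-cancelˡ-<ᵇ n) (cols-map-+ n xs ys)

isStandard : List ℕ → List ℕ → ℕ → Bool
isStandard xs ys n =
  incr xs ∧ incr ys ∧ cols xs ys ∧ allᵇ (λ k → occ (suc k) (xs ++ ys) ≡ᵇ 1) (upTo n)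

isStandard⁻ : ∀ xs ys n → T (isStandard xs ys n) →
  T (incr xs) × T (incr ys) × T (cols xs ys) × T (allᵇ (λ k → occ (suc k) (xs ++ ys) ≡ᵇ 1) (upTo n))
isStandard⁻ xs ys n h =
  let (incr-xs , h₁) = T-∧⁻ {incr xs} h
      (incr-ys , h₂) = T-∧⁻ {incr ys} h₁
  in  incr-xs , incr-ys , T-∧⁻ {cols xs ys} h₂

isStandard⇒occ≡1 : ∀ xs ys n → T (isStandard xs ys n) → ∀ {k} → k < n → occ (suc k) (xs ++ ys) ≡ 1
isStandard⇒occ≡1 xs ys n h k<n = ≡ᵇ⇒≡ _ 1 (applyUpTo⁻ id n (allᵇ⇒All (upTo n) once) k<n)
  where
  once : T (allᵇ (λ k → occ (suc k) (xs ++ ys) ≡ᵇ 1) (upTo n))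
  once = proj₂ (proj₂ (proj₂ (isStandard⁻ xs ys n h)))

occ-prepend : ∀ k xs ys →
  occ k ((1 ∷ List.map (2 +_) xs) ++ 2 ∷ List.map (2 +_) ys) ≡ occ k (2 ∷ 1 ∷ List.map (2 +_) (xs ++ ys))
occ-prepend k xs ys = begin
  occ k ((1 ∷ List.map (2 +_) xs) ++ 2 ∷ List.map (2 +_) ys)
    ≡⟨ occ-++-∷ k (1 ∷ List.map (2 +_) xs) 2 _ ⟩
  occ k (2 ∷ 1 ∷ List.map (2 +_) xs ++ List.map (2 +_) ys)
    ≡⟨ cong (λ zs → occ k (2 ∷ 1 ∷ zs)) (map-++ (2 +_) xs ys) ⟨
  occ k (2 ∷ 1 ∷ List.map (2 +_) (xs ++ ys))
    ∎

occ2-prepend : ∀ xs ys →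
  occ 2 ((1 ∷ List.map (2 +_) xs) ++ 2 ∷ List.map (2 +_) ys) ≡ suc (occ 0 (xs ++ ys))
occ2-prepend xs ys = trans (occ-prepend 2 xs ys) (cong suc (occ-map-+ 2 0 (xs ++ ys)))

isStandard-prepend : ∀ {n} xs ys → occ 0 (xs ++ ys) ≡ 0 →
  isStandard (1 ∷ List.map (2 +_) xs) (2 ∷ List.map (2 +_) ys) (2 + n) ≡ isStandard xs ys n
isStandard-prepend {n} xs ys occ0≡0 =
  cong₂ _∧_ (incr-∷-map-+ xs (s≤s (s≤s z≤n)))
  (cong₂ _∧_ incr-bottom
  (cong₂ _∧_ (cols-map-+ 2 xs ys) occurrences))
  where
  -- 2 ∷ List.map (2 +_) ys is List.map (2 +_) (0 ∷ ys).
  incr-bottom : incr (2 ∷ List.map (2 +_) ys) ≡ incr ys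
  incr-bottom = trans (incr-map-+ 2 (0 ∷ ys))
    (incr-0∷ ys (m+n≡0⇒n≡0 (occ 0 xs) (trans (sym (occ-++ 0 xs ys)) occ0≡0)))

  zs : List ℕ
  zs = (1 ∷ List.map (2 +_) xs) ++ 2 ∷ List.map (2 +_) ys

  occ1 : occ 1 zs ≡ 1
  occ1 = trans (occ-prepend 1 xs ys) (cong suc (occ-map-+-< (xs ++ ys) (s≤s (s≤s z≤n))))

  occ-3+ : ∀ k → occ (3 + k) zs ≡ occ (suc k) (xs ++ ys)
  occ-3+ k = trans (occ-prepend (3 + k) xs ys) (occ-map-+ 2 (suc k) (xs ++ ys))

  occurrences : allᵇ (λ k → occ (suc k) zs ≡ᵇ 1) (upTo (2 + n))
              ≡ allᵇ (λ k → occ (suc k) (xs ++ ys) ≡ᵇ 1) (upTo n)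
  occurrences =
    cong₂ _∧_ (cong (_≡ᵇ 1) occ1)
    (cong₂ _∧_ (cong (_≡ᵇ 1) (trans (occ2-prepend xs ys) (cong suc occ0≡0))) (begin
      allᵇ (λ k → occ (suc k) zs ≡ᵇ 1) (applyUpTo (2 +_) n)
        ≡⟨ cong (allᵇ _) (map-applyUpTo id (2 +_) n) ⟨
      allᵇ (λ k → occ (suc k) zs ≡ᵇ 1) (List.map (2 +_) (upTo n))
        ≡⟨ allᵇ-map (2 +_) (upTo n) ⟩
      allᵇ (λ k → occ (3 + k) zs ≡ᵇ 1) (upTo n)
        ≡⟨ allᵇ-cong (λ k → cong (_≡ᵇ 1) (occ-3+ k)) (upTo n) ⟩
      allᵇ (λ k → occ (suc k) (xs ++ ys) ≡ᵇ 1) (upTo n)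
        ∎))

isStandard-prepend⇒occ0≡0 : ∀ {n} xs ys →
  T (isStandard (1 ∷ List.map (2 +_) xs) (2 ∷ List.map (2 +_) ys) (2 + n)) → occ 0 (xs ++ ys) ≡ 0
isStandard-prepend⇒occ0≡0 {n} xs ys h = suc-injective (begin
  suc (occ 0 (xs ++ ys))  ≡⟨ occ2-prepend xs ys ⟨
  occ 2 (xs′ ++ ys′)      ≡⟨ isStandard⇒occ≡1 xs′ ys′ (2 + n) h (s≤s z<s) ⟩
  1                       ∎)
  where
  xs′ ys′ : List ℕ
  xs′ = 1 ∷ List.map (2 +_) xs
  ys′ = 2 ∷ List.map (2 +_) ys

entries : ∀ {a b} → Tab a b → List ℕ
entries (r₁ , r₂) = toList r₁ ++ toList r₂

isSYT⇒occ0≡0 : ∀ {a b} (t : Tab a b) → T (isSYT t) → occ 0 (entries t) ≡ 0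
isSYT⇒occ0≡0 {a} {b} (r₁ , r₂) h = pigeonhole-occ0 (entries (r₁ , r₂)) length-entries
  (λ k<n → occ≢0⇒∈ _ (λ occ≡0 → 0≢1+n (trans (sym occ≡0) (occ≡1 k<n))))
  where
  occ≡1 : ∀ {k} → k < a + b → occ (suc k) (entries (r₁ , r₂)) ≡ 1
  occ≡1 = isStandard⇒occ≡1 (toList r₁) (toList r₂) (a + b) h

  length-entries : length (entries (r₁ , r₂)) ≡ a + b
  length-entries = trans (length-++ (toList r₁)) (cong₂ _+_ (length-toList r₁) (length-toList r₂))

prependColumn : ∀ {a b} → Tab a b → Tab (suc a) (suc b)
prependColumn (r₁ , r₂) = 1 Vec.∷ Vec.map (2 +_) r₁ , 2 Vec.∷ Vec.map (2 +_) r₂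

removeFirstColumn : ∀ {a b} → Tab (suc a) (suc b) → Tab a b
removeFirstColumn (_ Vec.∷ r₁ , _ Vec.∷ r₂) = Vec.map (_∸ 2) r₁ , Vec.map (_∸ 2) r₂

isSYT-prependColumn-isStandard : ∀ {a b} (r₁ : Vec ℕ a) (r₂ : Vec ℕ b) →
  isSYT (prependColumn (r₁ , r₂))
    ≡ isStandard (1 ∷ List.map (2 +_) (toList r₁)) (2 ∷ List.map (2 +_) (toList r₂)) (2 + (a + b))
isSYT-prependColumn-isStandard {a} {b} r₁ r₂ = begin
  isSYT (prependColumn (r₁ , r₂))     ≡⟨ cong₂ (λ xs ys → isStandard (1 ∷ xs) (2 ∷ ys) (suc a + suc b))
                                              (toList-map (2 +_) r₁) (toList-map (2 +_) r₂) ⟩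
  isStandard xs′ ys′ (suc a + suc b)  ≡⟨ cong (isStandard xs′ ys′ ∘ suc) (+-suc a b) ⟩
  isStandard xs′ ys′ (2 + (a + b))    ∎
  where
  xs′ ys′ : List ℕ
  xs′ = 1 ∷ List.map (2 +_) (toList r₁)
  ys′ = 2 ∷ List.map (2 +_) (toList r₂)

isSYT-prependColumn : ∀ {a b} (t : Tab a b) → occ 0 (entries t) ≡ 0 → isSYT (prependColumn t) ≡ isSYT t
isSYT-prependColumn {a} {b} (r₁ , r₂) occ0≡0 = trans
  (isSYT-prependColumn-isStandard r₁ r₂)
  (isStandard-prepend {a + b} (toList r₁) (toList r₂) occ0≡0)

isSYT-prependColumn⇒occ0≡0 : ∀ {a b} (t : Tab a b) → T (isSYT (prependColumn t)) → occ 0 (entries t) ≡ 0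
isSYT-prependColumn⇒occ0≡0 {a} {b} (r₁ , r₂) h = isStandard-prepend⇒occ0≡0 {a + b}
  (toList r₁) (toList r₂) (subst T (isSYT-prependColumn-isStandard r₁ r₂) h)

isSYT-prependColumn⇔ : ∀ {a b} (t : Tab a b) → T (isSYT t) ⇔ T (isSYT (prependColumn t))
isSYT-prependColumn⇔ t = mk⇔
  (λ h → subst T (sym (isSYT-prependColumn t (isSYT⇒occ0≡0 t h))) h)
  (λ h → subst T (isSYT-prependColumn t (isSYT-prependColumn⇒occ0≡0 t h)) h)

isDes-prependColumn : ∀ {a b} (t : Tab a b) i → isDes (prependColumn t) (2 + i) ≡ isDes t i
isDes-prependColumn (r₁ , r₂) i = cong₂ _∧_
  (trans (cong ((2 + i) ∈ᵇ_) (toList-map (2 +_) r₁)) (∈ᵇ-map-+ 2 i (toList r₁)))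
  (trans (cong ((3 + i) ∈ᵇ_) (toList-map (2 +_) r₂)) (∈ᵇ-map-+ 2 (suc i) (toList r₂)))

desSup-prependColumn : ∀ {n a b} (J : Subset n) (t : Tab a b) → desSup 2 J (prependColumn t) ≡ desSup 0 J t
desSup-prependColumn J t = allᵇ-cong (λ j → cong (not (lookup J j) ∨_) (shift (suc (toℕ j)))) (allFin _)
  where
  shift : ∀ i → isDes (prependColumn t) (i + 2) ≡ isDes t (i + 0)
  shift i = begin
    isDes (prependColumn t) (i + 2)  ≡⟨ cong (isDes (prependColumn t)) (+-comm i 2) ⟩
    isDes (prependColumn t) (2 + i)  ≡⟨ isDes-prependColumn t i ⟩
    isDes t i                        ≡⟨ cong (isDes t) (+-identityʳ i) ⟨
    isDes t (i + 0)                  ∎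

map-∸-map-+ : ∀ {m} n (v : Vec ℕ m) → Vec.map (_∸ n) (Vec.map (n +_) v) ≡ v
map-∸-map-+ n v = begin
  Vec.map (_∸ n) (Vec.map (n +_) v)  ≡⟨ map-∘ (_∸ n) (n +_) v ⟨
  Vec.map (λ x → n + x ∸ n) v        ≡⟨ map-cong (m+n∸m≡n n) v ⟩
  Vec.map id v                       ≡⟨ map-id v ⟩
  v                                  ∎

map-+-map-∸ : ∀ {m} n (v : Vec ℕ m) → All (n ≤_) (toList v) → Vec.map (n +_) (Vec.map (_∸ n) v) ≡ v
map-+-map-∸ n Vec.[]       []          = refl
map-+-map-∸ n (x Vec.∷ v) (n≤x ∷ n≤v) = cong₂ Vec._∷_ (m+[n∸m]≡n n≤x) (map-+-map-∸ n v n≤v)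

removeFirstColumn-prependColumn : ∀ {a b} (t : Tab a b) → removeFirstColumn (prependColumn t) ≡ t
removeFirstColumn-prependColumn (r₁ , r₂) = cong₂ _,_ (map-∸-map-+ 2 r₁) (map-∸-map-+ 2 r₂)

prependColumn-removeFirstColumn : ∀ {a b} (t : Tab (suc a) (suc b)) → T (isSYT t) → T (isDes t 1) →
  prependColumn (removeFirstColumn t) ≡ t
prependColumn-removeFirstColumn {a} {b} t@(x Vec.∷ r₁ , y Vec.∷ r₂) syt des
  with incr₁ , incr₂ , x<ᵇy∧cols , _ ← isStandard⁻ (x ∷ toList r₁) (y ∷ toList r₂) (suc a + suc b) syt =
  cong₂ _,_ (cong₂ Vec._∷_ (sym x≡1) (map-+-map-∸ 2 r₁ 2≤r₁))
            (cong₂ Vec._∷_ (sym y≡2) (map-+-map-∸ 2 r₂ 2≤r₂))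
  where
  x<y : x < y
  x<y = <ᵇ⇒< x y (proj₁ (T-∧⁻ {x <ᵇ y} x<ᵇy∧cols))

  0<x : 0 < x
  0<x = occ0≡0⇒head>0 (toList r₁ ++ toList (y Vec.∷ r₂)) (isSYT⇒occ0≡0 t syt)

  x≡1 : x ≡ 1
  x≡1 = ≤-antisym (incr⇒head≤ (toList r₁) incr₁ (proj₁ (T-∧⁻ des))) 0<x

  y≡2 : y ≡ 2
  y≡2 = ≤-antisym (incr⇒head≤ (toList r₂) incr₂ (proj₂ (T-∧⁻ des))) (subst (_< y) x≡1 x<y)

  2≤r₁ : All (2 ≤_) (toList r₁)
  2≤r₁ = All.map (subst (_< _) x≡1) (incr⇒head<tail _ incr₁)

  2≤r₂ : All (2 ≤_) (toList r₂)
  2≤r₂ = All.map (<⇒≤ ∘ subst (_< _) y≡2) (incr⇒head<tail _ incr₂)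

prependColumn-spec : ∀ {n a b} (J : Subset n) (t : Tab a b) →
  T (isSYT t ∧ desSup 0 J t)
    ⇔ T (isSYT (prependColumn t) ∧ isDes (prependColumn t) 1 ∧ desSup 2 J (prependColumn t))
prependColumn-spec J t rewrite desSup-prependColumn J t =
  ⇔.trans T-∧ (⇔.trans (isSYT-prependColumn⇔ t ×-⇔ ⇔.refl) (⇔.sym T-∧))

Σ-T-↔ : ∀ {A B : Set} {P : A → Bool} {Q : B → Bool} (f : A → B) (g : B → A) →
  (∀ a → T (P a) ⇔ T (Q (f a))) → (∀ a → g (f a) ≡ a) → (∀ b → T (Q b) → f (g b) ≡ b) →
  Σ A (T ∘ P) ↔ Σ B (T ∘ Q)
Σ-T-↔ {A} {B} {P} {Q} f g P⇔Q∘f g∘f f∘g = mk↔ₛ′ to from to∘from from∘to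
  where
  to : Σ A (T ∘ P) → Σ B (T ∘ Q)
  to (a , p) = f a , Equivalence.to (P⇔Q∘f a) p

  from : Σ B (T ∘ Q) → Σ A (T ∘ P)
  from (b , q) = g b , Equivalence.from (P⇔Q∘f (g b)) (subst (T ∘ Q) (sym (f∘g b q)) q)

  to∘from : ∀ bq → to (from bq) ≡ bq
  to∘from (b , q) = Σ-≡,≡→≡ (f∘g b q , T-irrelevant _ _)

  from∘to : ∀ ap → from (to ap) ≡ ap
  from∘to (a , p) = Σ-≡,≡→≡ (g∘f a , T-irrelevant _ _)

lemma3p4 : (k₁ k₂ : ℕ) → k₂ ≤ k₁ → (J : Subset (k₁ + k₂ ∸ 1)) →
    (Σ (Tab k₁ k₂) (λ t → T (isSYT t ∧ desSup 0 J t)))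
      ↔ (Σ (Tab (suc k₁) (suc k₂)) (λ t → T (isSYT t ∧ isDes t 1 ∧ desSup 2 J t)))
lemma3p4 k₁ k₂ _ J = Σ-T-↔ prependColumn removeFirstColumn
  (prependColumn-spec J) removeFirstColumn-prependColumn
  (λ t h → let (syt , des∧J) = T-∧⁻ {isSYT t} h in
    prependColumn-removeFirstColumn t syt (proj₁ (T-∧⁻ {isDes t 1} des∧J)))
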